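{- Let $G$ be a complete signed graph, let $u\neq v$ with $\{u,v\}$ of sign $-$ in $G$, and let $H$ be obtained from $G$ by flipping the sign of $\{u,v\}$ to $+$. Let $w\notin N_{G^+}(u)\cup N_{G^+}(v)$ with $w\notin\{u,v\}$. Then for every $x\in N_{G^+}(w)$, $x$ and $w$ are in $\varepsilon$-agreement in $G^+$ if and only if they are in $\varepsilon$-agreement in $H^+$.
   Context: A complete signed graph on a finite vertex set $V$ assigns to every unordered pair of distinct vertices a sign $+$ or $-$. For such a graph $X$, its positive graph $X^+$ has vertex set $V$ and as edges the pairs of sign $+$; $N_{X^+}(a)$ is the open neighborhood of $a$ in $X^+$. Fix $\varepsilon>0$. $\mathrm{NonAgreement}_{X^+}(a,b)=\frac{|N_{X^+}(a)\,\Delta\,N_{X^+}(b)|}{\max\{|N_{X^+}(a)|,|N_{X^+}(b)|\}}$. Vertices $a,b$ are in $\varepsilon$-agreement in $X^+$ if $\{a,b\}$ is an edge of $X^+$ and $\mathrm{NonAgreement}_{X^+}(a,b)<\varepsilon$.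
   Formalization: The parameter ε ranges over the positive rationals instead of ℝ⁺. -}

module Defs where

open import Data.Bool using (Bool; true; false; if_then_else_; _∧_; _∨_; not)
open import Data.Nat as ℕ using (ℕ; zero; suc; _⊔_)
open import Data.Integer using (+_)
open import Data.Fin using (Fin; _≟_)
open import Data.Fin.Subset using (Subset; _∪_; _─_; ∣_∣; _∈_; _∉_)
open import Data.Vec using (tabulate)
open import Data.Rational using (ℚ; _/_; _<_; 0ℚ)
open import Data.Product using (_×_)
open import Relation.Nullary using (¬_)
open import Relation.Nullary.Decidable using (⌊_⌋)
open import Relation.Binary.PropositionalEquality using (_≡_)

-- A complete signed graph on vertex set Fin n: a sign for each pair
-- (true = +, false = -).  The value on the diagonal is irrelevant;
-- symmetry (unordered pairs) is imposed by the predicate Symmetric.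
SignedGraph : ℕ → Set
SignedGraph n = Fin n → Fin n → Bool

Symmetric : ∀ {n} → SignedGraph n → Set
Symmetric X = ∀ a b → X a b ≡ X b a

posAdj : ∀ {n} → SignedGraph n → Fin n → Fin n → Bool
posAdj X a b = not ⌊ a ≟ b ⌋ ∧ X a b

PosEdge : ∀ {n} → SignedGraph n → Fin n → Fin n → Set
PosEdge X a b = ¬ (a ≡ b) × X a b ≡ true

N⁺ : ∀ {n} → SignedGraph n → Fin n → Subset n
N⁺ X a = tabulate (λ b → posAdj X a b)

_Δ_ : ∀ {n} → Subset n → Subset n → Subset n
p Δ q = (p ─ q) ∪ (q ─ p)

-- NonAgreement_{X⁺}(a,b) = |N(a) Δ N(b)| / max{|N(a)|,|N(b)|}
-- (convention: 0 when the denominator is 0; never relevant for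
-- ε-agreement since a,b are then adjacent and the max is ≥ 1)
NonAgreement : ∀ {n} → SignedGraph n → Fin n → Fin n → ℚ
NonAgreement X a b with ∣ N⁺ X a ∣ ⊔ ∣ N⁺ X b ∣
... | zero  = 0ℚ
... | suc m = (+ ∣ N⁺ X a Δ N⁺ X b ∣) / suc m

Agreement : ∀ {n} → ℚ → SignedGraph n → Fin n → Fin n → Set
Agreement ε X a b = PosEdge X a b × NonAgreement X a b < ε

flipPos : ∀ {n} → SignedGraph n → Fin n → Fin n → SignedGraph n
flipPos X u v x y =
  if (⌊ x ≟ u ⌋ ∧ ⌊ y ≟ v ⌋) ∨ (⌊ x ≟ v ⌋ ∧ ⌊ y ≟ u ⌋) then true else X x y

{-# OPTIONS --safe #-}
module Submission where

-- Flipping {u,v} only changes the rows of u and v.  Whether x and w agree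
-- depends only on the rows of x and w, and neither x nor w is u or v:
-- for w this is a hypothesis, and x is a positive neighbour of w, which
-- is adjacent to neither u nor v.

open import Defs
open import Data.Bool using (true; false; not; _∧_)
open import Data.Nat using (ℕ; zero; suc; _⊔_)
open import Data.Integer using (+_)
open import Data.Fin using (Fin; _≟_)
open import Data.Fin.Subset using (Subset; _∈_; _∉_; _∪_; ∣_∣)
open import Data.Fin.Subset.Properties using (x∈p∪q⁺)
open import Data.Rational using (ℚ; 0ℚ; _<_) renaming (_/_ to _÷_)
open import Data.Product using (_,_)
open import Data.Sum using (inj₁; inj₂)
open import Data.Vec.Properties using ([]=⇒lookup; lookup⇒[]=; lookup∘tabulate; tabulate-cong)
open import Relation.Nullary using (¬_; yes; no)
open import Data.Empty using (⊥-elim)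
open import Relation.Binary.PropositionalEquality using (_≡_; refl; sym; trans; cong; cong₂; subst)
open import Function.Bundles using (_⇔_; mk⇔)

∈N⁺⇒PosEdge : ∀ {n} (X : SignedGraph n) a b → b ∈ N⁺ X a → PosEdge X a b
∈N⁺⇒PosEdge X a b b∈ with a ≟ b | trans (sym (lookup∘tabulate (posAdj X a) b)) ([]=⇒lookup b∈)
... | no a≢b | Xab = a≢b , Xab

PosEdge⇒∈N⁺ : ∀ {n} (X : SignedGraph n) a b → PosEdge X a b → b ∈ N⁺ X a
PosEdge⇒∈N⁺ X a b (a≢b , Xab) =
  lookup⇒[]= b (N⁺ X a) (trans (lookup∘tabulate (posAdj X a) b) posAdj≡true)
  where
  posAdj≡true : posAdj X a b ≡ true
  posAdj≡true with a ≟ b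
  ... | yes a≡b = ⊥-elim (a≢b a≡b)
  ... | no _    = Xab

PosEdge-sym : ∀ {n} {X : SignedGraph n} → Symmetric X → ∀ {a b} → PosEdge X a b → PosEdge X b a
PosEdge-sym X-sym {a} {b} (a≢b , Xab) = (λ b≡a → a≢b (sym b≡a)) , trans (X-sym b a) Xab

∈N⁺-sym : ∀ {n} {X : SignedGraph n} → Symmetric X → ∀ {a b} → b ∈ N⁺ X a → a ∈ N⁺ X b
∈N⁺-sym {X = X} X-sym {a} {b} b∈ = PosEdge⇒∈N⁺ X b a (PosEdge-sym X-sym (∈N⁺⇒PosEdge X a b b∈))

SameRow : ∀ {n} → SignedGraph n → SignedGraph n → Fin n → Set
SameRow X Y a = ∀ y → X a y ≡ Y a y

N⁺-cong : ∀ {n} (X Y : SignedGraph n) a → SameRow X Y a → N⁺ X a ≡ N⁺ Y a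
N⁺-cong X Y a same = tabulate-cong λ y → cong (not _ ∧_) (same y)

nonAgreement : ∀ {n} → Subset n → Subset n → ℚ
nonAgreement p q with ∣ p ∣ ⊔ ∣ q ∣
... | zero  = 0ℚ
... | suc m = (+ ∣ p Δ q ∣) ÷ suc m

NonAgreement≡nonAgreement : ∀ {n} (X : SignedGraph n) a b →
  NonAgreement X a b ≡ nonAgreement (N⁺ X a) (N⁺ X b)
NonAgreement≡nonAgreement X a b with ∣ N⁺ X a ∣ ⊔ ∣ N⁺ X b ∣
... | zero  = refl
... | suc m = refl

NonAgreement-cong : ∀ {n} {X Y : SignedGraph n} {a b} → SameRow X Y a → SameRow X Y b →
  NonAgreement X a b ≡ NonAgreement Y a b
NonAgreement-cong {X = X} {Y} {a} {b} sameA sameB =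
  trans (NonAgreement≡nonAgreement X a b)
    (trans (cong₂ nonAgreement (N⁺-cong X Y a sameA) (N⁺-cong X Y b sameB))
      (sym (NonAgreement≡nonAgreement Y a b)))

Agreement-cong : ∀ {n} ε {X Y : SignedGraph n} {a b} → SameRow X Y a → SameRow X Y b →
  Agreement ε X a b ⇔ Agreement ε Y a b
Agreement-cong ε {a = a} {b} sameA sameB = mk⇔
  (λ { ((a≢b , Xab) , NA<ε) → (a≢b , trans (sym (sameA b)) Xab) , subst (_< ε) NA≡ NA<ε })
  (λ { ((a≢b , Yab) , NA<ε) → (a≢b , trans (sameA b) Yab) , subst (_< ε) (sym NA≡) NA<ε })
  where NA≡ = NonAgreement-cong sameA sameB

flipPos-SameRow : ∀ {n} (G : SignedGraph n) {u v a} → ¬ (a ≡ u) → ¬ (a ≡ v) →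
  SameRow G (flipPos G u v) a
flipPos-SameRow G {u} {v} {a} a≢u a≢v y with a ≟ u | a ≟ v
... | yes a≡u | _       = ⊥-elim (a≢u a≡u)
... | no _    | yes a≡v = ⊥-elim (a≢v a≡v)
... | no _    | no _    = refl

proposition2 : (ε : ℚ) → 0ℚ < ε → (n : ℕ) → (G : SignedGraph n) → Symmetric G →
    (u v : Fin n) → ¬ (u ≡ v) → G u v ≡ false →
    (w : Fin n) → w ∉ (N⁺ G u ∪ N⁺ G v) → ¬ (w ≡ u) → ¬ (w ≡ v) →
    (x : Fin n) → x ∈ N⁺ G w →
    Agreement ε G x w ⇔ Agreement ε (flipPos G u v) x w
proposition2 ε _ n G G-sym u v _ _ w w∉ w≢u w≢v x x∈ =
  Agreement-cong ε (flipPos-SameRow G x≢u x≢v) (flipPos-SameRow G w≢u w≢v)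
  where
  w∈Nx : w ∈ N⁺ G x
  w∈Nx = ∈N⁺-sym G-sym x∈
  x≢u : ¬ (x ≡ u)
  x≢u refl = w∉ (x∈p∪q⁺ (inj₁ w∈Nx))
  x≢v : ¬ (x ≡ v)
  x≢v refl = w∉ (x∈p∪q⁺ (inj₂ w∈Nx))
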